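{- Let $(\mathbb{L}_S,\mathbb{L}_P,\lozenge,\Diamond)$ be a normal heterogeneous $\mathcal{L}_{\mathrm{MT}}$-algebra. For any $f\in\mathsf{F}_{\mathbf{A}}(\mathbb{L}_P)$, $v\in\mathsf{C}_{\mathbf{A}}(\mathbb{L}_S)$, $g\in\mathsf{F}_{\mathbf{A}}(\mathbb{L}_S)$ and $u\in\mathsf{C}_{\mathbf{A}}(\mathbb{L}_P)$: (1) $\bigwedge_{s\in\mathbb{L}_S}(f^{ -\Diamond}(s)\to v(s))=\bigwedge_{p\in\mathbb{L}_P}(f(p)\to v(\Diamond p))$; (2) $\bigwedge_{p\in\mathbb{L}_P}(g^{ -\lozenge}(p)\to u(p))=\bigwedge_{s\in\mathbb{L}_S}(g(s)\to u(\lozenge s))$.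
   Context: $\mathbf{A}=(D,1,0,\vee,\wedge,\otimes,\to)$ is a fixed complete commutative residuated lattice which is frame-distributive and dually frame-distributive. A normal heterogeneous $\mathcal{L}_{\mathrm{MT}}$-algebra is $(\mathbb{L}_S,\mathbb{L}_P,\lozenge,\Diamond)$ with bounded lattices $\mathbb{L}_S,\mathbb{L}_P$, $\lozenge:\mathbb{L}_S\to\mathbb{L}_P$, $\Diamond:\mathbb{L}_P\to\mathbb{L}_S$ preserving $\bot$ and binary joins. For a bounded lattice $\mathbb{L}$: $\mathsf{F}_{\mathbf{A}}(\mathbb{L})$ is the set of proper $\mathbf{A}$-filters, i.e. maps $f:\mathbb{L}\to\mathbf{A}$ with $f(\top)=1$, $f(\bot)=0$, $f(a\wedge b)=f(a)\wedge f(b)$; $\mathsf{C}_{\mathbf{A}}(\mathbb{L})$ is the set of complements of proper $\mathbf{A}$-ideals, i.e. maps $u:\mathbb{L}\to\mathbf{A}$ with $u(\bot)=0$, $u(\top)=1$, $u(a\vee b)=u(a)\vee u(b)$. For $k:\mathbb{L}_P\to\mathbf{A}$, $k^{ -\Diamond}(s)=\bigvee\{k(p)\mid\Diamond p\le s\}$ ($s\in\mathbb{L}_S$); for $h:\mathbb{L}_S\to\mathbf{A}$, $h^{ -\lozenge}(p)=\bigvee\{h(s)\mid\lozenge s\le p\}$ ($p\in\mathbb{L}_P$). -}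

module Defs where

open import Level using (Level; _⊔_) renaming (suc to lsuc)
open import Data.Product using (Σ; _×_; proj₁)
open import Relation.Binary.Lattice.Bundles using (BoundedLattice)
open import Relation.Binary.Lattice.Structures using (IsBoundedLattice)
open import Algebra.Structures using (IsCommutativeMonoid)

record CompleteCRL (a ℓ₁ ℓ₂ ι : Level) : Set (lsuc (a ⊔ ℓ₁ ⊔ ℓ₂ ⊔ ι)) where
  infix  4 _≈_ _≤_
  infixr 6 _∨_
  infixr 7 _∧_
  infixr 7 _⊗_
  infixr 5 _⇒_
  field
    Carrier : Set a
    _≈_     : Carrier → Carrier → Set ℓ₁
    _≤_     : Carrier → Carrier → Set ℓ₂
    _∨_ _∧_ _⊗_ _⇒_ : Carrier → Carrier → Carrier
    𝟏 𝟎     : Carrier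
    isBoundedLattice : IsBoundedLattice _≈_ _≤_ _∨_ _∧_ 𝟏 𝟎
    ⊗-isCommutativeMonoid : IsCommutativeMonoid _≈_ _⊗_ 𝟏
    residuated₁ : ∀ x y z → x ⊗ y ≤ z → y ≤ x ⇒ z
    residuated₂ : ∀ x y z → y ≤ x ⇒ z → x ⊗ y ≤ z
    ⋁ ⋀ : {I : Set ι} → (I → Carrier) → Carrier
    ⋁-upper : {I : Set ι} (h : I → Carrier) (i : I) → h i ≤ ⋁ h
    ⋁-least : {I : Set ι} (h : I → Carrier) (x : Carrier) → (∀ i → h i ≤ x) → ⋁ h ≤ x
    ⋀-lower : {I : Set ι} (h : I → Carrier) (i : I) → ⋀ h ≤ h i
    ⋀-greatest : {I : Set ι} (h : I → Carrier) (x : Carrier) → (∀ i → x ≤ h i) → x ≤ ⋀ h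

module _ {a ℓ₁ ℓ₂ ι} (A : CompleteCRL a ℓ₁ ℓ₂ ι) where
  open CompleteCRL A

  FrameDistributive : Set (a ⊔ ℓ₁ ⊔ lsuc ι)
  FrameDistributive = {I : Set ι} (x : Carrier) (h : I → Carrier) →
    (x ∧ ⋁ h) ≈ ⋁ (λ i → x ∧ h i)

  DuallyFrameDistributive : Set (a ⊔ ℓ₁ ⊔ lsuc ι)
  DuallyFrameDistributive = {I : Set ι} (x : Carrier) (h : I → Carrier) →
    (x ∨ ⋀ h) ≈ ⋀ (λ i → x ∨ h i)

record NormalHetAlg (ι : Level) : Set (lsuc ι) where
  field
    LS LP : BoundedLattice ι ι ι
  module S = BoundedLattice LS
  module P = BoundedLattice LP
  field
    ◇ : S.Carrier → P.Carrier          -- lozenge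
    ◆ : P.Carrier → S.Carrier          -- Diamond
    ◇-cong : ∀ {x y} → x S.≈ y → ◇ x P.≈ ◇ y
    ◆-cong : ∀ {x y} → x P.≈ y → ◆ x S.≈ ◆ y
    ◇-⊥ : ◇ S.⊥ P.≈ P.⊥
    ◆-⊥ : ◆ P.⊥ S.≈ S.⊥
    ◇-∨ : ∀ x y → ◇ (x S.∨ y) P.≈ (◇ x P.∨ ◇ y)
    ◆-∨ : ∀ x y → ◆ (x P.∨ y) S.≈ (◆ x S.∨ ◆ y)

module _ {a ℓ₁ ℓ₂ ι} (A : CompleteCRL a ℓ₁ ℓ₂ ι) (L : BoundedLattice ι ι ι) where
  private
    module A = CompleteCRL A
    module L = BoundedLattice L

  record IsFilter (f : L.Carrier → A.Carrier) : Set (a ⊔ ℓ₁ ⊔ ι) where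
    field
      cong : ∀ {x y} → x L.≈ y → f x A.≈ f y
      top  : f L.⊤ A.≈ A.𝟏
      bot  : f L.⊥ A.≈ A.𝟎
      meet : ∀ x y → f (x L.∧ y) A.≈ (f x A.∧ f y)

  -- complement of a proper A-ideal
  record IsCoIdeal (u : L.Carrier → A.Carrier) : Set (a ⊔ ℓ₁ ⊔ ι) where
    field
      cong : ∀ {x y} → x L.≈ y → u x A.≈ u y
      bot  : u L.⊥ A.≈ A.𝟎
      top  : u L.⊤ A.≈ A.𝟏
      join : ∀ x y → u (x L.∨ y) A.≈ (u x A.∨ u y)

module _ {a ℓ₁ ℓ₂ ι} (A : CompleteCRL a ℓ₁ ℓ₂ ι) (H : NormalHetAlg ι) where
  private
    module A = CompleteCRL A
  open NormalHetAlg H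

  preimage◆ : (P.Carrier → A.Carrier) → S.Carrier → A.Carrier
  preimage◆ k s = A.⋁ {Σ P.Carrier (λ p → ◆ p S.≤ s)} (λ i → k (proj₁ i))

  preimage◇ : (S.Carrier → A.Carrier) → P.Carrier → A.Carrier
  preimage◇ h p = A.⋁ {Σ S.Carrier (λ s → ◇ s P.≤ p)} (λ i → h (proj₁ i))

module Submission where

-- Both halves of the theorem are instances of one identity about a complete
-- commutative residuated lattice A.  For any map m : X → Y into a poset Y,
-- any weight f : X → A and any monotone v : Y → A,
--
--     ⋀_y ( (⋁ { f x | m x ≤ y }) ⇒ v y )  =  ⋀_x ( f x ⇒ v (m x) ).
--
-- "≤": instantiate y := m x, where f x is one of the joinands.
-- "≥": for m x ≤ y we have f x ⇒ v (m x) ≤ f x ⇒ v y by monotonicity of v,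
-- and a join on the left of ⇒ turns into a meet (residuation).

open import Defs
open import Level using (Level)
open import Data.Product using (_×_; _,_; Σ; proj₁; proj₂)
open import Relation.Binary.Bundles using (Poset)
open import Relation.Binary.Lattice.Bundles using (BoundedLattice)
open import Relation.Binary.Lattice.Structures using (IsBoundedLattice)
open import Algebra.Structures using (IsCommutativeMonoid)

module ResiduatedLatticeFacts {a ℓ₁ ℓ₂ ι : Level} (A : CompleteCRL a ℓ₁ ℓ₂ ι) where
  open CompleteCRL A
  open IsBoundedLattice isBoundedLattice
  private
    module ⊗ = IsCommutativeMonoid ⊗-isCommutativeMonoid

  residuatedˡ : ∀ x y z → x ⊗ y ≤ z → x ≤ y ⇒ z
  residuatedˡ x y z xy≤z = residuated₁ y x z (≤-respˡ-≈ (⊗.comm x y) xy≤z)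

  residuatedˡ⁻¹ : ∀ x y z → x ≤ y ⇒ z → x ⊗ y ≤ z
  residuatedˡ⁻¹ x y z x≤y⇒z = ≤-respˡ-≈ (⊗.comm y x) (residuated₂ y x z x≤y⇒z)

  modusPonens : ∀ x z → x ⊗ (x ⇒ z) ≤ z
  modusPonens x z = residuated₂ x (x ⇒ z) z refl

  ⇒-monotone : ∀ x {y z} → y ≤ z → x ⇒ y ≤ x ⇒ z
  ⇒-monotone x {y} y≤z = residuated₁ x (x ⇒ y) _ (trans (modusPonens x y) y≤z)

  -- A join in the premise of ⇒: if c ≤ h i ⇒ z for every i, then c ≤ ⋁ h ⇒ z.
  -- By residuation c ≤ x ⇒ z  iff  x ≤ c ⇒ z, so this is ⋁-least for c ⇒ z.
  ⋁-⇒ : {I : Set ι} (h : I → Carrier) (c z : Carrier) →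
        (∀ i → c ≤ h i ⇒ z) → c ≤ ⋁ h ⇒ z
  ⋁-⇒ h c z c≤h⇒z = residuated₁ (⋁ h) c z
    (residuatedˡ⁻¹ (⋁ h) c z
      (⋁-least h (c ⇒ z) λ i →
        residuatedˡ (h i) c z (residuated₂ (h i) c z (c≤h⇒z i))))

  -- A smaller premise gives a larger implication: since y ≤ (y ⇒ z) ⇒ z,
  -- any x ≤ y satisfies x ⊗ (y ⇒ z) ≤ z.
  ⇒-antitone : ∀ {x y} z → x ≤ y → y ⇒ z ≤ x ⇒ z
  ⇒-antitone {x} {y} z x≤y = residuated₁ x (y ⇒ z) z
    (residuatedˡ⁻¹ x (y ⇒ z) z (trans x≤y (residuatedˡ y (y ⇒ z) z (modusPonens y z))))

  ⋀-⇒-preimage : {X : Set ι} (Y : Poset ι ι ι) (m : X → Poset.Carrier Y)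
    (f : X → Carrier) (v : Poset.Carrier Y → Carrier) →
    (∀ {y y′} → Poset._≤_ Y y y′ → v y ≤ v y′) →
    ⋀ (λ y → ⋁ {Σ X (λ x → Poset._≤_ Y (m x) y)} (λ j → f (proj₁ j)) ⇒ v y)
      ≈ ⋀ (λ x → f x ⇒ v (m x))
  ⋀-⇒-preimage {X} Y m f v v-monotone = antisym preimage≤image image≤preimage
    where
    module Y = Poset Y
    preimageJoin : Y.Carrier → Carrier
    preimageJoin y = ⋁ {Σ X (λ x → m x Y.≤ y)} (λ j → f (proj₁ j))

    overPreimage overImage : Carrier
    overPreimage = ⋀ (λ y → preimageJoin y ⇒ v y)
    overImage    = ⋀ (λ x → f x ⇒ v (m x))

    -- Take y := m x; f x is one of the joinands of preimageJoin (m x).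
    preimage≤image : overPreimage ≤ overImage
    preimage≤image = ⋀-greatest _ overPreimage λ x →
      trans (⋀-lower _ (m x))
            (⇒-antitone (v (m x)) (⋁-upper (λ j → f (proj₁ j)) (x , Y.refl)))

    -- For m x ≤ y, the x-th implication already bounds f x ⇒ v y.
    image≤preimage : overImage ≤ overPreimage
    image≤preimage = ⋀-greatest _ overImage λ y →
      ⋁-⇒ (λ j → f (proj₁ j)) overImage (v y) λ { (x , mx≤y) →
        trans (⋀-lower _ x) (⇒-monotone (f x) (v-monotone mx≤y)) }

-- The complement of a proper A-ideal is monotone: x ≤ y gives x ∨ y ≈ y,
-- hence u y ≈ u x ∨ u y ≥ u x.
coIdeal-monotone : ∀ {a ℓ₁ ℓ₂ ι} (A : CompleteCRL a ℓ₁ ℓ₂ ι) (L : BoundedLattice ι ι ι)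
  (u : BoundedLattice.Carrier L → CompleteCRL.Carrier A) → IsCoIdeal A L u →
  ∀ {x y} → BoundedLattice._≤_ L x y → CompleteCRL._≤_ A (u x) (u y)
coIdeal-monotone A L u isCoIdeal {x} {y} x≤y =
  A.trans (proj₁ (A.supremum (u x) (u y)))
          (A.reflexive (A.Eq.trans (A.Eq.sym (join x y)) (cong x∨y≈y)))
  where
  module A = IsBoundedLattice (CompleteCRL.isBoundedLattice A)
  module L = BoundedLattice L
  open IsCoIdeal isCoIdeal
  x∨y≈y : x L.∨ y L.≈ y
  x∨y≈y = L.antisym (proj₂ (proj₂ (L.supremum x y)) y x≤y L.refl)
                    (proj₁ (proj₂ (L.supremum x y)))

mainTheorem5 : ∀ {a ℓ₁ ℓ₂ ι} (A : CompleteCRL a ℓ₁ ℓ₂ ι) →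
    FrameDistributive A → DuallyFrameDistributive A →
    (H : NormalHetAlg ι) →
    let open CompleteCRL A
        open NormalHetAlg H
    in (f : P.Carrier → Carrier) → IsFilter A LP f →
       (v : S.Carrier → Carrier) → IsCoIdeal A LS v →
       (g : S.Carrier → Carrier) → IsFilter A LS g →
       (u : P.Carrier → Carrier) → IsCoIdeal A LP u →
       (⋀ (λ s → preimage◆ A H f s ⇒ v s) ≈ ⋀ (λ p → f p ⇒ v (◆ p)))
       × (⋀ (λ p → preimage◇ A H g p ⇒ u p) ≈ ⋀ (λ s → g s ⇒ u (◇ s)))
mainTheorem5 A _ _ H f _ v v-coIdeal g _ u u-coIdeal =
    ⋀-⇒-preimage S.poset ◆ f v (coIdeal-monotone A LS v v-coIdeal)
  , ⋀-⇒-preimage P.poset ◇ g u (coIdeal-monotone A LP u u-coIdeal)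
  where
  open ResiduatedLatticeFacts A
  open NormalHetAlg H
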